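{- Let $n$ be a Carmichael number. Then both $n^{d\lambda(n)}$ and $n^{d\varphi(n)}$ are weak Carmichael numbers for every positive integer $d$.
   Context: $\lambda(m)$ denotes the Carmichael function: the smallest positive integer $t$ such that $a^t\equiv 1\pmod m$ for all integers $a$ coprime to $m$; $\varphi$ is Euler's totient function. A Carmichael number is a composite positive integer $n$ with $a^{n-1}\equiv 1\pmod n$ for all integers $a$ coprime to $n$. A composite positive integer $n$ is called a weak Carmichael number if $\sum_{1\le k\le n-1,\ \gcd(k,n)=1} k^{n-1}\equiv \varphi(n)\pmod{n}$. -}

module Defs where

open import Data.Nat using (ℕ; zero; suc; _+_; _*_; _∸_; _^_; _<_; _≤_)
open import Data.Nat.GCD using (gcd)
open import Data.Nat.Coprimality using (Coprime)
open import Data.Nat.Primality using (Composite)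
open import Data.Integer as ℤ using (ℤ; +_)
open import Data.Integer.Divisibility using () renaming (_∣_ to _∣ℤ_)
open import Data.List using (List; []; _∷_; filter; map; length)
open import Data.Nat.ListAction using (sum)
open import Data.List.Base using (upTo)
open import Data.Nat using (_≟_)
open import Relation.Binary.PropositionalEquality using (_≡_)
open import Relation.Nullary using (¬_)
open import Data.Product using (_×_)

_≡_[mod_] : ℕ → ℕ → ℕ → Set
a ≡ b [mod m ] = (+ m) ∣ℤ ((+ a) ℤ.- (+ b))

range1 : ℕ → List ℕ
range1 n = map suc (upTo (n ∸ 1))

unitsUpTo : ℕ → List ℕ
unitsUpTo n = filter (λ k → gcd k n ≟ 1) (map suc (upTo n))

φ : ℕ → ℕ
φ n = length (unitsUpTo n)

IsCarmichaelλ : ℕ → ℕ → Set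
IsCarmichaelλ m t =
  0 < t
  × (∀ a → Coprime a m → (a ^ t) ≡ 1 [mod m ])
  × (∀ s → 0 < s → s < t → ¬ (∀ a → Coprime a m → (a ^ s) ≡ 1 [mod m ]))

IsCarmichael : ℕ → Set
IsCarmichael n = Composite n × (∀ a → Coprime a n → (a ^ (n ∸ 1)) ≡ 1 [mod n ])

IsWeakCarmichael : ℕ → Set
IsWeakCarmichael n =
  Composite n
  × (sum (map (λ k → k ^ (n ∸ 1)) (filter (λ k → gcd k n ≟ 1) (range1 n)))) ≡ φ n [mod n ]

module Submission where

-- A Carmichael number n is odd: if n were even, a = n − 1 ≡ −1 (mod n) would give
-- a^(n−1) ≡ −1, so the Carmichael condition would force n ∣ 2. Fix N = n^(f+1), M = N − 1,
-- and write k < N as k = q n + r with r < n, q < n^f; k is a unit mod N iff r is a unit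
-- mod n. For odd n, ∑_{q < n^f} (r + n q)^M ≡ n^f r^M (mod n^(f+1)): going from f to f + 1
-- replaces each term x^M by ∑_{t < n} (x + K t)^M with K = n^(f+1), which is
-- n x^M + c K ∑_{t < n} t (mod K²), and n ∣ ∑_{t < n} t = n (n − 1) / 2. Since n − 1 ∣ N − 1,
-- a unit r has r^M ≡ 1 (mod n), so each unit residue class contributes n^f (r^M − 1) ≡ 0
-- (mod N) to ∑_{units k} (k^M − 1); that is, ∑_{units k} k^M ≡ φ(N) (mod N).

open import Defs
open import Data.Nat using (ℕ; _^_; _*_; _<_)
open import Data.Product using (_×_)

open import Data.Nat as ℕ using (zero; suc; _∸_; _≟_; NonZero)
import Data.Nat.Properties as ℕ
open import Data.Nat.Divisibility as ℕ
  using (_∣_; ∣-trans; ∣-refl; _∣0; ∣1⇒≡1; ∣m∣n⇒∣m+n; ∣m+n∣m⇒∣n; m∣m*n; n∣m*n)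
open import Data.Nat.Coprimality
  using (Coprime; coprime?; coprime⇒gcd≡1; gcd≡1⇒coprime; coprime-divisor; 0-coprimeTo-m⇒m≡1; 1-coprimeTo)
open import Data.Nat.GCD using (gcd)
open import Data.Nat.Primality
  using (Composite; composite-∣; composite⇒nonZero; composite⇒nonTrivial; ¬composite[0]; 2-rough)
open import Data.Nat.ListAction using (sum)
open import Data.Integer as ℤ using (ℤ; +_; 0ℤ; 1ℤ; -1ℤ)
  renaming (_+_ to _+ᶻ_; _-_ to _-ᶻ_; _*_ to _*ᶻ_; _^_ to _^ᶻ_)
import Data.Integer.Properties as ℤ
open import Data.Integer.Divisibility.Signed as ℤ using (divides; quotient; ∣ᵤ⇒∣; ∣⇒∣ᵤ) renaming (_∣_ to _∣ᶻ_)
open import Data.Integer.Tactic.RingSolver using (solve-∀)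
open import Data.List using (filter; map; length)
open import Data.List.Base using (upTo; applyUpTo)
open import Data.List.Properties using (map-applyUpTo; filter-accept)
open import Data.Product using (∃; _,_; proj₁)
open import Data.Sum using (_⊎_; inj₁; inj₂)
open import Function using (id; _∘_)
open import Relation.Binary.Bundles using (Setoid)
open import Relation.Binary.PropositionalEquality
open import Relation.Nullary using (¬_; Dec; yes; no; contradiction)
open import Relation.Unary using (Pred; Decidable)

-- Congruences of integers

infix 4 _≡ᶻ_[mod_]
record _≡ᶻ_[mod_] (x y m : ℤ) : Set where
  constructor ∣⇒≡mod
  field ≡mod⇒∣ : m ∣ᶻ x -ᶻ y
open _≡ᶻ_[mod_]

module _ {m : ℤ} where

  ≡mod-reflexive : ∀ {x y} → x ≡ y → x ≡ᶻ y [mod m ]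
  ≡mod-reflexive {x} refl = ∣⇒≡mod (divides 0ℤ (trans (ℤ.+-inverseʳ x) (sym (ℤ.*-zeroˡ m))))

  ≡mod-refl : ∀ {x} → x ≡ᶻ x [mod m ]
  ≡mod-refl = ≡mod-reflexive refl

  ≡mod-sym : ∀ {x y} → x ≡ᶻ y [mod m ] → y ≡ᶻ x [mod m ]
  ≡mod-sym {x} {y} (∣⇒≡mod p) = ∣⇒≡mod (subst (m ∣ᶻ_) (negate x y) (ℤ.∣m⇒∣-m p))
    where
    negate : ∀ x y → ℤ.- (x -ᶻ y) ≡ y -ᶻ x
    negate = solve-∀

  ≡mod-trans : ∀ {x y z} → x ≡ᶻ y [mod m ] → y ≡ᶻ z [mod m ] → x ≡ᶻ z [mod m ]
  ≡mod-trans {x} {y} {z} (∣⇒≡mod p) (∣⇒≡mod q) =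
    ∣⇒≡mod (subst (m ∣ᶻ_) (telescope x y z) (ℤ.∣m∣n⇒∣m+n p q))
    where
    telescope : ∀ x y z → (x -ᶻ y) +ᶻ (y -ᶻ z) ≡ x -ᶻ z
    telescope = solve-∀

  +-cong-mod : ∀ {x y u v} → x ≡ᶻ y [mod m ] → u ≡ᶻ v [mod m ] → x +ᶻ u ≡ᶻ y +ᶻ v [mod m ]
  +-cong-mod {x} {y} {u} {v} (∣⇒≡mod p) (∣⇒≡mod q) =
    ∣⇒≡mod (subst (m ∣ᶻ_) (regroup x y u v) (ℤ.∣m∣n⇒∣m+n p q))
    where
    regroup : ∀ x y u v → (x -ᶻ y) +ᶻ (u -ᶻ v) ≡ (x +ᶻ u) -ᶻ (y +ᶻ v)
    regroup = solve-∀

  *-cong-mod : ∀ {x y u v} → x ≡ᶻ y [mod m ] → u ≡ᶻ v [mod m ] → x *ᶻ u ≡ᶻ y *ᶻ v [mod m ]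
  *-cong-mod {x} {y} {u} {v} (∣⇒≡mod p) (∣⇒≡mod q) =
    ∣⇒≡mod (subst (m ∣ᶻ_) (regroup x y u v) (ℤ.∣m∣n⇒∣m+n (ℤ.∣n⇒∣m*n x q) (ℤ.∣n⇒∣m*n v p)))
    where
    regroup : ∀ x y u v → x *ᶻ (u -ᶻ v) +ᶻ v *ᶻ (x -ᶻ y) ≡ x *ᶻ u -ᶻ y *ᶻ v
    regroup = solve-∀

  ^-cong-mod : ∀ {x y} k → x ≡ᶻ y [mod m ] → x ^ᶻ k ≡ᶻ y ^ᶻ k [mod m ]
  ^-cong-mod zero    _   = ≡mod-refl
  ^-cong-mod (suc k) x≡y = *-cong-mod x≡y (^-cong-mod k x≡y)

  ≡mod-weaken : ∀ {k x y} → k ∣ᶻ m → x ≡ᶻ y [mod m ] → x ≡ᶻ y [mod k ]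
  ≡mod-weaken k∣m (∣⇒≡mod p) = ∣⇒≡mod (ℤ.∣-trans k∣m p)

*-scale-mod : ∀ {m x y} c → x ≡ᶻ y [mod m ] → c *ᶻ x ≡ᶻ c *ᶻ y [mod c *ᶻ m ]
*-scale-mod {x = x} {y} c (∣⇒≡mod p) =
  ∣⇒≡mod (subst (c *ᶻ _ ∣ᶻ_) (distrib c x y) (ℤ.*-monoʳ-∣ c p))
  where
  distrib : ∀ c x y → c *ᶻ (x -ᶻ y) ≡ c *ᶻ x -ᶻ c *ᶻ y
  distrib = solve-∀

≡mod-setoid : ℤ → Setoid _ _
≡mod-setoid m = record
  { Carrier       = ℤ
  ; _≈_           = λ x y → x ≡ᶻ y [mod m ]
  ; isEquivalence = record { refl = ≡mod-refl ; sym = ≡mod-sym ; trans = ≡mod-trans }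
  }

module ≡mod-Reasoning (m : ℤ) where
  open import Relation.Binary.Reasoning.Setoid (≡mod-setoid m) public

fromℕ-≡mod : ∀ {a b m} → a ≡ b [mod m ] → + a ≡ᶻ + b [mod + m ]
fromℕ-≡mod a≡b = ∣⇒≡mod (∣ᵤ⇒∣ a≡b)

toℕ-≡mod : ∀ {a b m} → + a ≡ᶻ + b [mod + m ] → a ≡ b [mod m ]
toℕ-≡mod (∣⇒≡mod p) = ∣⇒∣ᵤ p

pos-^ : ∀ a k → + (a ^ k) ≡ (+ a) ^ᶻ k
pos-^ a zero    = refl
pos-^ a (suc k) = trans (ℤ.pos-* a (a ^ k)) (cong (+ a *ᶻ_) (pos-^ a k))

pos-*-+ : ∀ q b r → + (q * b ℕ.+ r) ≡ + r +ᶻ + b *ᶻ + q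
pos-*-+ q b r = begin
  + (q * b ℕ.+ r)      ≡⟨ ℤ.pos-+ (q * b) r ⟩
  + (q * b) +ᶻ + r     ≡⟨ cong (_+ᶻ + r) (ℤ.pos-* q b) ⟩
  + q *ᶻ + b +ᶻ + r    ≡⟨ swap (+ q) (+ b) (+ r) ⟩
  + r +ᶻ + b *ᶻ + q    ∎
  where
  open ≡-Reasoning
  swap : ∀ q b r → q *ᶻ b +ᶻ r ≡ r +ᶻ b *ᶻ q
  swap = solve-∀

-- Finite sums of integers

∑ : ℕ → (ℕ → ℤ) → ℤ
∑ zero    f = 0ℤ
∑ (suc m) f = f 0 +ᶻ ∑ m (f ∘ suc)

infix 7 ∑
syntax ∑ m (λ i → e) = ∑[ i < m ] e

∑-cong : ∀ m {f g} → (∀ i → f i ≡ g i) → ∑ m f ≡ ∑ m g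
∑-cong zero    f≡g = refl
∑-cong (suc m) f≡g = cong₂ _+ᶻ_ (f≡g 0) (∑-cong m (f≡g ∘ suc))

∑-cong-mod : ∀ m {d f g} → (∀ i → f i ≡ᶻ g i [mod d ]) → ∑ m f ≡ᶻ ∑ m g [mod d ]
∑-cong-mod zero    f≡g = ≡mod-refl
∑-cong-mod (suc m) f≡g = +-cong-mod (f≡g 0) (∑-cong-mod m (f≡g ∘ suc))

∑-0 : ∀ m → ∑[ i < m ] 0ℤ ≡ 0ℤ
∑-0 zero    = refl
∑-0 (suc m) = trans (ℤ.+-identityˡ _) (∑-0 m)

∑-+ : ∀ m f g → ∑[ i < m ] (f i +ᶻ g i) ≡ ∑ m f +ᶻ ∑ m g
∑-+ zero    f g = refl
∑-+ (suc m) f g = begin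
  (f 0 +ᶻ g 0) +ᶻ ∑[ i < m ] (f (suc i) +ᶻ g (suc i))
    ≡⟨ cong ((f 0 +ᶻ g 0) +ᶻ_) (∑-+ m (f ∘ suc) (g ∘ suc)) ⟩
  (f 0 +ᶻ g 0) +ᶻ (∑ m (f ∘ suc) +ᶻ ∑ m (g ∘ suc))
    ≡⟨ interchange (f 0) (g 0) _ _ ⟩
  (f 0 +ᶻ ∑ m (f ∘ suc)) +ᶻ (g 0 +ᶻ ∑ m (g ∘ suc))
    ∎
  where
  open ≡-Reasoning
  interchange : ∀ a b x y → (a +ᶻ b) +ᶻ (x +ᶻ y) ≡ (a +ᶻ x) +ᶻ (b +ᶻ y)
  interchange = solve-∀

∑-*ˡ : ∀ m c f → ∑[ i < m ] (c *ᶻ f i) ≡ c *ᶻ ∑ m f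
∑-*ˡ zero    c f = sym (ℤ.*-zeroʳ c)
∑-*ˡ (suc m) c f = trans (cong (c *ᶻ f 0 +ᶻ_) (∑-*ˡ m c (f ∘ suc))) (sym (ℤ.*-distribˡ-+ c (f 0) _))

∑-const : ∀ m c → ∑[ i < m ] c ≡ + m *ᶻ c
∑-const zero    c = sym (ℤ.*-zeroˡ c)
∑-const (suc m) c = trans (cong (c +ᶻ_) (∑-const m c)) (sym (ℤ.suc-* (+ m) c))

∑-last : ∀ m f → ∑ (suc m) f ≡ ∑ m f +ᶻ f m
∑-last zero    f = ℤ.+-comm (f 0) 0ℤ
∑-last (suc m) f = trans (cong (f 0 +ᶻ_) (∑-last m (f ∘ suc))) (sym (ℤ.+-assoc (f 0) _ _))

∑-drop-head : ∀ m f → f 0 ≡ 0ℤ → ∑ (suc m) f ≡ ∑ m (f ∘ suc)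
∑-drop-head m f f0≡0 = trans (cong (_+ᶻ ∑ m (f ∘ suc)) f0≡0) (ℤ.+-identityˡ _)

∑-drop-last : ∀ m f → f m ≡ 0ℤ → ∑ (suc m) f ≡ ∑ m f
∑-drop-last m f fm≡0 = trans (∑-last m f) (trans (cong (∑ m f +ᶻ_) fm≡0) (ℤ.+-identityʳ _))

∑-+-range : ∀ a b f → ∑ (a ℕ.+ b) f ≡ ∑ a f +ᶻ ∑[ k < b ] f (a ℕ.+ k)
∑-+-range zero    b f = sym (ℤ.+-identityˡ _)
∑-+-range (suc a) b f = trans (cong (f 0 +ᶻ_) (∑-+-range a b (f ∘ suc))) (sym (ℤ.+-assoc (f 0) _ _))

∑-swap : ∀ a b (h : ℕ → ℕ → ℤ) → ∑[ i < a ] ∑[ j < b ] h i j ≡ ∑[ j < b ] ∑[ i < a ] h i j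
∑-swap zero    b h = sym (∑-0 b)
∑-swap (suc a) b h =
  trans (cong (∑ b (h 0) +ᶻ_) (∑-swap a b (h ∘ suc))) (sym (∑-+ b (h 0) (λ j → ∑[ i < a ] h (suc i) j)))

∑-blocks : ∀ a b f → ∑ (a * b) f ≡ ∑[ q < a ] ∑[ r < b ] f (q * b ℕ.+ r)
∑-blocks zero    b f = refl
∑-blocks (suc a) b f = begin
  ∑ (b ℕ.+ a * b) f
    ≡⟨ ∑-+-range b (a * b) f ⟩
  ∑ b f +ᶻ ∑[ k < a * b ] f (b ℕ.+ k)
    ≡⟨ cong (∑ b f +ᶻ_) (∑-blocks a b (f ∘ (b ℕ.+_))) ⟩
  ∑ b f +ᶻ ∑[ q < a ] ∑[ r < b ] f (b ℕ.+ (q * b ℕ.+ r))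
    ≡⟨ cong (∑ b f +ᶻ_) (∑-cong a λ q → ∑-cong b λ r → cong f (sym (ℕ.+-assoc b (q * b) r))) ⟩
  ∑ b f +ᶻ ∑[ q < a ] ∑[ r < b ] f (suc q * b ℕ.+ r)
    ∎
  where open ≡-Reasoning

∑-by-residue : ∀ a b f → ∑ (a * b) f ≡ ∑[ r < b ] ∑[ q < a ] f (q * b ℕ.+ r)
∑-by-residue a b f = trans (∑-blocks a b f) (∑-swap a b λ q r → f (q * b ℕ.+ r))

∑-odd-range : ∀ h → ∑[ t < suc (h * 2) ] + t ≡ + suc (h * 2) *ᶻ + h
∑-odd-range zero    = refl
∑-odd-range (suc h) = begin
  ∑[ t < suc (suc s) ] + t
    ≡⟨ ∑-last (suc s) +_ ⟩
  ∑[ t < suc s ] + t +ᶻ + suc s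
    ≡⟨ cong (_+ᶻ + suc s) (∑-last s +_) ⟩
  ∑[ t < s ] + t +ᶻ + s +ᶻ + suc s
    ≡⟨ cong (λ x → x +ᶻ + s +ᶻ + suc s) (∑-odd-range h) ⟩
  + s *ᶻ + h +ᶻ + s +ᶻ (1ℤ +ᶻ + s)
    ≡⟨ cong (λ z → z *ᶻ + h +ᶻ z +ᶻ (1ℤ +ᶻ z)) s≡1+2h ⟩
  (1ℤ +ᶻ + h *ᶻ + 2) *ᶻ + h +ᶻ (1ℤ +ᶻ + h *ᶻ + 2) +ᶻ (1ℤ +ᶻ (1ℤ +ᶻ + h *ᶻ + 2))
    ≡⟨ expand (+ h) ⟩
  (1ℤ +ᶻ (1ℤ +ᶻ (1ℤ +ᶻ + h *ᶻ + 2))) *ᶻ (1ℤ +ᶻ + h)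
    ≡⟨ cong (λ z → (1ℤ +ᶻ (1ℤ +ᶻ z)) *ᶻ (1ℤ +ᶻ + h)) s≡1+2h ⟨
  + suc (suc s) *ᶻ + suc h
    ∎
  where
  open ≡-Reasoning
  s = suc (h * 2)
  s≡1+2h : + s ≡ 1ℤ +ᶻ + h *ᶻ + 2
  s≡1+2h = cong (1ℤ +ᶻ_) (ℤ.pos-* h 2)
  expand : ∀ z → (1ℤ +ᶻ z *ᶻ + 2) *ᶻ z +ᶻ (1ℤ +ᶻ z *ᶻ + 2) +ᶻ (1ℤ +ᶻ (1ℤ +ᶻ z *ᶻ + 2))
                 ≡ (1ℤ +ᶻ (1ℤ +ᶻ (1ℤ +ᶻ z *ᶻ + 2))) *ᶻ (1ℤ +ᶻ z)
  expand = solve-∀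

restrict : ∀ {p} {P : Set p} → Dec P → ℤ → ℤ
restrict (yes _) x = x
restrict (no _)  _ = 0ℤ

restrict-accept : ∀ {p} {P : Set p} (P? : Dec P) {x} → P → restrict P? x ≡ x
restrict-accept (yes _) _ = refl
restrict-accept (no ¬p) p = contradiction p ¬p

restrict-reject : ∀ {p} {P : Set p} (P? : Dec P) {x} → ¬ P → restrict P? x ≡ 0ℤ
restrict-reject (yes p) ¬p = contradiction p ¬p
restrict-reject (no _)  _  = refl

restrict-+ : ∀ {p} {P : Set p} (P? : Dec P) x y → restrict P? (x +ᶻ y) ≡ restrict P? x +ᶻ restrict P? y
restrict-+ (yes _) x y = refl
restrict-+ (no _)  x y = refl

module _ {p} {P : Pred ℕ p} (P? : Decidable P) where

  sum-filter-applyUpTo : ∀ (g f : ℕ → ℕ) m →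
    + sum (map g (filter P? (applyUpTo f m))) ≡ ∑[ i < m ] restrict (P? (f i)) (+ g (f i))
  sum-filter-applyUpTo g f zero = refl
  sum-filter-applyUpTo g f (suc m) with P? (f 0)
  ... | yes _ = trans (ℤ.pos-+ (g (f 0)) _) (cong (+ g (f 0) +ᶻ_) (sum-filter-applyUpTo g (f ∘ suc) m))
  ... | no  _ = trans (sum-filter-applyUpTo g (f ∘ suc) m) (sym (ℤ.+-identityˡ _))

  length-filter-applyUpTo : ∀ (f : ℕ → ℕ) m →
    + length (filter P? (applyUpTo f m)) ≡ ∑[ i < m ] restrict (P? (f i)) 1ℤ
  length-filter-applyUpTo f zero = refl
  length-filter-applyUpTo f (suc m) with P? (f 0)
  ... | yes _ = cong (1ℤ +ᶻ_) (length-filter-applyUpTo (f ∘ suc) m)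
  ... | no  _ = trans (length-filter-applyUpTo (f ∘ suc) m) (sym (ℤ.+-identityˡ _))

¬coprime[0,n] : ∀ {N} → 1 < N → ¬ Coprime 0 N
¬coprime[0,n] 1<N c = ℕ.<⇒≢ 1<N (sym (0-coprimeTo-m⇒m≡1 c))

¬coprime[n,n] : ∀ {N} → 1 < N → ¬ Coprime N N
¬coprime[n,n] 1<N c = ℕ.<⇒≢ 1<N (sym (c (∣-refl , ∣-refl)))

weak-sum≡∑ : ∀ N → 1 < N →
  + sum (map (λ k → k ^ (N ∸ 1)) (filter (λ k → gcd k N ≟ 1) (range1 N)))
    ≡ ∑[ k < N ] restrict (gcd k N ≟ 1) (+ (k ^ (N ∸ 1)))
weak-sum≡∑ N@(suc N-1) 1<N = begin
  + sum (map g (filter Q? (map suc (upTo N-1))))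
    ≡⟨ cong (λ xs → + sum (map g (filter Q? xs))) (map-applyUpTo id suc N-1) ⟩
  + sum (map g (filter Q? (applyUpTo suc N-1)))
    ≡⟨ sum-filter-applyUpTo Q? g suc N-1 ⟩
  ∑[ i < N-1 ] R (suc i)
    ≡⟨ ∑-drop-head N-1 R (restrict-reject (Q? 0) (¬coprime[0,n] 1<N ∘ gcd≡1⇒coprime)) ⟨
  ∑[ k < N ] R k
    ∎
  where
  open ≡-Reasoning
  g = λ k → k ^ (N ∸ 1)
  Q? = λ k → gcd k N ≟ 1
  R = λ k → restrict (Q? k) (+ g k)

φ≡∑ : ∀ N → 1 < N → + φ N ≡ ∑[ k < N ] restrict (gcd k N ≟ 1) 1ℤ
φ≡∑ N 1<N = begin
  + length (filter Q? (map suc (upTo N)))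
    ≡⟨ cong (λ xs → + length (filter Q? xs)) (map-applyUpTo id suc N) ⟩
  + length (filter Q? (applyUpTo suc N))
    ≡⟨ length-filter-applyUpTo Q? suc N ⟩
  ∑[ i < N ] R (suc i)
    ≡⟨ ∑-drop-head N R (restrict-reject (Q? 0) (¬coprime[0,n] 1<N ∘ gcd≡1⇒coprime)) ⟨
  ∑[ k < suc N ] R k
    ≡⟨ ∑-drop-last N R (restrict-reject (Q? N) (¬coprime[n,n] 1<N ∘ gcd≡1⇒coprime)) ⟩
  ∑[ k < N ] R k
    ∎
  where
  open ≡-Reasoning
  Q? = λ k → gcd k N ≟ 1
  R = λ k → restrict (Q? k) 1ℤ

φ>0 : ∀ n → .{{NonZero n}} → 0 < φ n
φ>0 (suc m) = subst (0 <_) (cong length (sym 1-kept)) ℕ.z<s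
  where
  1-kept = filter-accept (λ k → gcd k (suc m) ≟ 1) {x = 1} {xs = map suc (applyUpTo suc m)}
                         (coprime⇒gcd≡1 (1-coprimeTo (suc m)))

-- Elementary number theory

coprime-*-+ : ∀ {r n} q → Coprime r n → Coprime (q * n ℕ.+ r) n
coprime-*-+ q c (d∣q*n+r , d∣n) = c (∣m+n∣m⇒∣n d∣q*n+r (∣-trans d∣n (n∣m*n q)) , d∣n)

coprime-*-+⁻¹ : ∀ {r n} q → Coprime (q * n ℕ.+ r) n → Coprime r n
coprime-*-+⁻¹ q c (d∣r , d∣n) = c (∣m∣n⇒∣m+n (∣-trans d∣n (n∣m*n q)) d∣r , d∣n)

coprime-^ : ∀ {k n} → Coprime k n → ∀ e → Coprime k (n ^ e)
coprime-^ c zero    (d∣k , d∣1)     = ∣1⇒≡1 d∣1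
coprime-^ c (suc e) (d∣k , d∣n*n^e) =
  coprime-^ c e (d∣k , coprime-divisor (λ (i∣d , i∣n) → c (∣-trans i∣d d∣k , i∣n)) d∣n*n^e)

coprime-^⁻¹ : ∀ {k n e} → Coprime k (n ^ suc e) → Coprime k n
coprime-^⁻¹ c (d∣k , d∣n) = c (d∣k , ∣-trans d∣n (m∣m*n _))

coprime-suc : ∀ a → Coprime a (suc a)
coprime-suc a {d} (d∣a , d∣1+a) = ∣1⇒≡1 (∣m+n∣m⇒∣n (subst (d ∣_) (ℕ.+-comm 1 a) d∣1+a) d∣a)

[n∸1]∣[n^e∸1] : ∀ n e → n ∸ 1 ∣ n ^ e ∸ 1
[n∸1]∣[n^e∸1] zero    zero    = ∣-refl
[n∸1]∣[n^e∸1] zero    (suc e) = ∣-refl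
[n∸1]∣[n^e∸1] (suc m) zero    = m ∣0
[n∸1]∣[n^e∸1] (suc m) (suc e) =
  subst (m ∣_) (sym (ℕ.+-∸-comm (m * suc m ^ e) (ℕ.m^n>0 (suc m) e)))
        (∣m∣n⇒∣m+n ([n∸1]∣[n^e∸1] (suc m) e) (m∣m*n _))

^-≡1-mod-∣ : ∀ {m x s t} → t ∣ s → x ^ᶻ t ≡ᶻ 1ℤ [mod m ] → x ^ᶻ s ≡ᶻ 1ℤ [mod m ]
^-≡1-mod-∣ {m} {x} {t = t} (ℕ.divides q refl) x^t≡1 = begin
  x ^ᶻ (q * t)    ≡⟨ cong (x ^ᶻ_) (ℕ.*-comm q t) ⟩
  x ^ᶻ (t * q)    ≡⟨ ℤ.^-*-assoc x t q ⟨
  (x ^ᶻ t) ^ᶻ q   ≈⟨ ^-cong-mod q x^t≡1 ⟩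
  1ℤ ^ᶻ q         ≡⟨ ℤ.^-zeroˡ q ⟩
  1ℤ              ∎
  where open ≡mod-Reasoning m

parity : ∀ n → (∃ λ h → n ≡ h * 2) ⊎ (∃ λ h → n ≡ suc (h * 2))
parity zero    = inj₁ (0 , refl)
parity (suc n) with parity n
... | inj₁ (h , refl) = inj₂ (h , refl)
... | inj₂ (h , refl) = inj₁ (suc h , refl)

-1^odd : ∀ h → -1ℤ ^ᶻ suc (h * 2) ≡ -1ℤ
-1^odd zero    = refl
-1^odd (suc h) = cong (λ z → -1ℤ *ᶻ (-1ℤ *ᶻ z)) (-1^odd h)

carmichael-odd : ∀ {n} → IsCarmichael n → ∃ λ h → n ≡ suc (h * 2)
carmichael-odd {n} (composite , korselt) with parity n
... | inj₂ odd             = odd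
... | inj₁ (zero , refl)  = contradiction composite ¬composite[0]
... | inj₁ (suc h , refl) = contradiction (composite-∣ composite n∣2) 2-rough
  where
  a = suc (h * 2)
  a≡-1 : + a ≡ᶻ -1ℤ [mod + suc a ]
  a≡-1 = ∣⇒≡mod (divides 1ℤ (trans (cong +_ (ℕ.+-comm a 1)) (sym (ℤ.*-identityˡ (+ suc a)))))
  -1≡1 : -1ℤ ≡ᶻ 1ℤ [mod + suc a ]
  -1≡1 = begin
    -1ℤ          ≡⟨ -1^odd h ⟨
    -1ℤ ^ᶻ a     ≈⟨ ^-cong-mod a (≡mod-sym a≡-1) ⟩
    (+ a) ^ᶻ a   ≡⟨ pos-^ a a ⟨
    + (a ^ a)    ≈⟨ fromℕ-≡mod (korselt a (coprime-suc a)) ⟩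
    1ℤ           ∎
    where open ≡mod-Reasoning (+ suc a)
  n∣2 : suc a ∣ 2
  n∣2 = ∣⇒∣ᵤ (≡mod⇒∣ -1≡1)

carmichael-^-≡1 : ∀ {n} → IsCarmichael n → ∀ e {a} → Coprime a n → (+ a) ^ᶻ (n ^ e ∸ 1) ≡ᶻ 1ℤ [mod + n ]
carmichael-^-≡1 {n} (_ , korselt) e {a} c = ^-≡1-mod-∣ ([n∸1]∣[n^e∸1] n e) a^[n∸1]≡1
  where
  a^[n∸1]≡1 = subst (_≡ᶻ 1ℤ [mod + n ]) (pos-^ a (n ∸ 1)) (fromℕ-≡mod (korselt a c))

-- Power sums along arithmetic progressions

binomial-mod-square : ∀ x M → ∃ λ c → ∀ y → (x +ᶻ y) ^ᶻ M ≡ᶻ x ^ᶻ M +ᶻ c *ᶻ y [mod y *ᶻ y ]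
binomial-mod-square x zero    = 0ℤ , λ y → ≡mod-reflexive (sym (ℤ.+-identityʳ 1ℤ))
binomial-mod-square x (suc M) with binomial-mod-square x M
... | c , expand = x *ᶻ c +ᶻ x ^ᶻ M , expand-suc
  where
  square-term : ∀ x y X c → (x +ᶻ y) *ᶻ (X +ᶻ c *ᶻ y) -ᶻ (x *ᶻ X +ᶻ (x *ᶻ c +ᶻ X) *ᶻ y) ≡ c *ᶻ (y *ᶻ y)
  square-term = solve-∀
  expand-suc : ∀ y → (x +ᶻ y) ^ᶻ suc M ≡ᶻ x ^ᶻ suc M +ᶻ (x *ᶻ c +ᶻ x ^ᶻ M) *ᶻ y [mod y *ᶻ y ]
  expand-suc y = begin
    (x +ᶻ y) *ᶻ (x +ᶻ y) ^ᶻ M              ≈⟨ *-cong-mod (≡mod-refl {x = x +ᶻ y}) (expand y) ⟩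
    (x +ᶻ y) *ᶻ (x ^ᶻ M +ᶻ c *ᶻ y)         ≈⟨ ∣⇒≡mod (divides c (square-term x y (x ^ᶻ M) c)) ⟩
    x *ᶻ x ^ᶻ M +ᶻ (x *ᶻ c +ᶻ x ^ᶻ M) *ᶻ y ∎
    where open ≡mod-Reasoning (y *ᶻ y)

module _ (n : ℕ) (n∣∑ : + n ∣ᶻ ∑[ t < n ] + t) where

  ∑-translates-^ : ∀ M x {K} → + n ∣ᶻ K →
    ∑[ t < n ] (x +ᶻ K *ᶻ + t) ^ᶻ M ≡ᶻ + n *ᶻ x ^ᶻ M [mod + n *ᶻ K ]
  ∑-translates-^ M x {K} n∣K with binomial-mod-square x M
  ... | c , expand = begin
    ∑[ t < n ] (x +ᶻ K *ᶻ + t) ^ᶻ M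
      ≈⟨ ∑-cong-mod n (λ t → ≡mod-weaken (nK∣square t) (expand (K *ᶻ + t))) ⟩
    ∑[ t < n ] (x ^ᶻ M +ᶻ c *ᶻ (K *ᶻ + t))
      ≡⟨ ∑-+ n (λ _ → x ^ᶻ M) (λ t → c *ᶻ (K *ᶻ + t)) ⟩
    ∑[ t < n ] x ^ᶻ M +ᶻ ∑[ t < n ] (c *ᶻ (K *ᶻ + t))
      ≡⟨ cong₂ _+ᶻ_ (∑-const n (x ^ᶻ M)) (trans (∑-*ˡ n c (λ t → K *ᶻ + t)) (cong (c *ᶻ_) (∑-*ˡ n K +_))) ⟩
    + n *ᶻ x ^ᶻ M +ᶻ c *ᶻ (K *ᶻ (∑[ t < n ] + t))
      ≈⟨ +-cong-mod (≡mod-refl {x = + n *ᶻ x ^ᶻ M}) linear-term≡0 ⟩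
    + n *ᶻ x ^ᶻ M +ᶻ 0ℤ
      ≡⟨ ℤ.+-identityʳ _ ⟩
    + n *ᶻ x ^ᶻ M
      ∎
    where
    open ≡mod-Reasoning (+ n *ᶻ K)
    nK∣square : ∀ t → + n *ᶻ K ∣ᶻ (K *ᶻ + t) *ᶻ (K *ᶻ + t)
    nK∣square t = ℤ.∣-trans (ℤ.*-monoˡ-∣ K n∣K) (divides (+ t *ᶻ + t) (regroup K (+ t)))
      where
      regroup : ∀ K t → (K *ᶻ t) *ᶻ (K *ᶻ t) ≡ (t *ᶻ t) *ᶻ (K *ᶻ K)
      regroup = solve-∀
    linear-term≡0 : c *ᶻ (K *ᶻ (∑[ t < n ] + t)) ≡ᶻ 0ℤ [mod + n *ᶻ K ]
    linear-term≡0 = ∣⇒≡mod (divides (c *ᶻ quotient n∣∑)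
      (trans (cong (λ s → c *ᶻ (K *ᶻ s) -ᶻ 0ℤ) (_∣ᶻ_.equality n∣∑)) (regroup c K (quotient n∣∑) (+ n))))
      where
      regroup : ∀ c K q n → c *ᶻ (K *ᶻ (q *ᶻ n)) -ᶻ 0ℤ ≡ c *ᶻ q *ᶻ (n *ᶻ K)
      regroup = solve-∀

  progression-index : ∀ a f r t →
    a +ᶻ + n *ᶻ + (t * n ^ f ℕ.+ r) ≡ a +ᶻ + n *ᶻ + r +ᶻ (+ n) ^ᶻ suc f *ᶻ + t
  progression-index a f r t = begin
    a +ᶻ P *ᶻ + (t * n ^ f ℕ.+ r)          ≡⟨ cong (λ z → a +ᶻ P *ᶻ z) (pos-*-+ t (n ^ f) r) ⟩
    a +ᶻ P *ᶻ (+ r +ᶻ + (n ^ f) *ᶻ + t)    ≡⟨ cong (λ z → a +ᶻ P *ᶻ (+ r +ᶻ z *ᶻ + t)) (pos-^ n f) ⟩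
    a +ᶻ P *ᶻ (+ r +ᶻ P ^ᶻ f *ᶻ + t)       ≡⟨ regroup a P (+ r) (P ^ᶻ f) (+ t) ⟩
    a +ᶻ P *ᶻ + r +ᶻ P ^ᶻ suc f *ᶻ + t     ∎
    where
    open ≡-Reasoning
    P = + n
    regroup : ∀ a P r Q t → a +ᶻ P *ᶻ (r +ᶻ Q *ᶻ t) ≡ a +ᶻ P *ᶻ r +ᶻ P *ᶻ Q *ᶻ t
    regroup = solve-∀

  ∑-progression-^ : ∀ M f a →
    ∑[ j < n ^ f ] (a +ᶻ + n *ᶻ + j) ^ᶻ M ≡ᶻ (+ n) ^ᶻ f *ᶻ a ^ᶻ M [mod (+ n) ^ᶻ suc f ]
  ∑-progression-^ M zero    a = ≡mod-reflexive (begin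
    (a +ᶻ + n *ᶻ 0ℤ) ^ᶻ M +ᶻ 0ℤ   ≡⟨ ℤ.+-identityʳ _ ⟩
    (a +ᶻ + n *ᶻ 0ℤ) ^ᶻ M         ≡⟨ cong (λ z → (a +ᶻ z) ^ᶻ M) (ℤ.*-zeroʳ (+ n)) ⟩
    (a +ᶻ 0ℤ) ^ᶻ M                ≡⟨ cong (_^ᶻ M) (ℤ.+-identityʳ a) ⟩
    a ^ᶻ M                        ≡⟨ ℤ.*-identityˡ (a ^ᶻ M) ⟨
    1ℤ *ᶻ a ^ᶻ M                  ∎)
    where open ≡-Reasoning
  ∑-progression-^ M (suc f) a = begin
    ∑[ j < n * n ^ f ] G j
      ≡⟨ ∑-by-residue n (n ^ f) G ⟩
    ∑[ r < n ^ f ] ∑[ t < n ] G (t * n ^ f ℕ.+ r)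
      ≡⟨ ∑-cong (n ^ f) (λ r → ∑-cong n λ t → cong (_^ᶻ M) (progression-index a f r t)) ⟩
    ∑[ r < n ^ f ] ∑[ t < n ] (a +ᶻ P *ᶻ + r +ᶻ P ^ᶻ suc f *ᶻ + t) ^ᶻ M
      ≈⟨ ∑-cong-mod (n ^ f) (λ r → ∑-translates-^ M (a +ᶻ P *ᶻ + r) n∣P^[1+f]) ⟩
    ∑[ r < n ^ f ] (P *ᶻ (a +ᶻ P *ᶻ + r) ^ᶻ M)
      ≡⟨ ∑-*ˡ (n ^ f) P (λ r → (a +ᶻ P *ᶻ + r) ^ᶻ M) ⟩
    P *ᶻ (∑[ r < n ^ f ] (a +ᶻ P *ᶻ + r) ^ᶻ M)
      ≈⟨ *-scale-mod P (∑-progression-^ M f a) ⟩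
    P *ᶻ (P ^ᶻ f *ᶻ a ^ᶻ M)
      ≡⟨ ℤ.*-assoc P (P ^ᶻ f) (a ^ᶻ M) ⟨
    P ^ᶻ suc f *ᶻ a ^ᶻ M
      ∎
    where
    open ≡mod-Reasoning ((+ n) ^ᶻ suc (suc f))
    P = + n
    G = λ j → (a +ᶻ P *ᶻ + j) ^ᶻ M
    n∣P^[1+f] : P ∣ᶻ P ^ᶻ suc f
    n∣P^[1+f] = divides (P ^ᶻ f) (ℤ.*-comm P (P ^ᶻ f))

  ∑-progression-^-1≡0 : ∀ M f {x} → x ^ᶻ M ≡ᶻ 1ℤ [mod + n ] →
    ∑[ j < n ^ f ] ((x +ᶻ + n *ᶻ + j) ^ᶻ M -ᶻ 1ℤ) ≡ᶻ 0ℤ [mod (+ n) ^ᶻ suc f ]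
  ∑-progression-^-1≡0 M f {x} x^M≡1 = begin
    ∑[ j < n ^ f ] (G j -ᶻ 1ℤ)
      ≡⟨ ∑-+ (n ^ f) G (λ _ → -1ℤ) ⟩
    ∑ (n ^ f) G +ᶻ ∑[ j < n ^ f ] -1ℤ
      ≡⟨ cong (∑ (n ^ f) G +ᶻ_) (∑-const (n ^ f) -1ℤ) ⟩
    ∑ (n ^ f) G +ᶻ + (n ^ f) *ᶻ -1ℤ
      ≈⟨ +-cong-mod (∑-progression-^ M f x) ≡mod-refl ⟩
    P ^ᶻ f *ᶻ x ^ᶻ M +ᶻ + (n ^ f) *ᶻ -1ℤ
      ≈⟨ +-cong-mod (≡mod-weaken P^[1+f]∣P^f*P (*-scale-mod (P ^ᶻ f) x^M≡1)) ≡mod-refl ⟩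
    P ^ᶻ f *ᶻ 1ℤ +ᶻ + (n ^ f) *ᶻ -1ℤ
      ≡⟨ cong (λ z → P ^ᶻ f *ᶻ 1ℤ +ᶻ z *ᶻ -1ℤ) (pos-^ n f) ⟩
    P ^ᶻ f *ᶻ 1ℤ +ᶻ P ^ᶻ f *ᶻ -1ℤ
      ≡⟨ cancel (P ^ᶻ f) ⟩
    0ℤ
      ∎
    where
    open ≡mod-Reasoning ((+ n) ^ᶻ suc f)
    P = + n
    P^[1+f]∣P^f*P : P ^ᶻ suc f ∣ᶻ P ^ᶻ f *ᶻ P
    P^[1+f]∣P^f*P = ℤ.∣-reflexive (ℤ.*-comm P (P ^ᶻ f))
    G = λ j → (x +ᶻ P *ᶻ + j) ^ᶻ M
    cancel : ∀ Q → Q *ᶻ 1ℤ +ᶻ Q *ᶻ -1ℤ ≡ 0ℤ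
    cancel = solve-∀

-- Powers of Carmichael numbers

odd⇒∣∑ : ∀ h → + suc (h * 2) ∣ᶻ ∑[ t < suc (h * 2) ] + t
odd⇒∣∑ h = divides (+ h) (trans (∑-odd-range h) (ℤ.*-comm (+ suc (h * 2)) (+ h)))

carmichael⇒∣∑ : ∀ {n} → IsCarmichael n → + n ∣ᶻ ∑[ t < n ] + t
carmichael⇒∣∑ c with carmichael-odd c
... | h , refl = odd⇒∣∑ h

module _ {n : ℕ} (carmichael : IsCarmichael n) (f : ℕ) where

  private
    N = n ^ suc f
    M = N ∸ 1
    Q? = λ k → gcd k N ≟ 1
    R = λ k → restrict (Q? k) (+ (k ^ M) -ᶻ 1ℤ)

  ∑-residue-class≡0 : ∀ r → ∑[ q < n ^ f ] R (q * n ℕ.+ r) ≡ᶻ 0ℤ [mod + N ]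
  ∑-residue-class≡0 r with coprime? r n
  ... | no ¬c = ≡mod-reflexive (trans (∑-cong (n ^ f) nonunit-term) (∑-0 (n ^ f)))
    where
    nonunit-term : ∀ q → R (q * n ℕ.+ r) ≡ 0ℤ
    nonunit-term q =
      restrict-reject (Q? (q * n ℕ.+ r)) (¬c ∘ coprime-*-+⁻¹ q ∘ coprime-^⁻¹ {e = f} ∘ gcd≡1⇒coprime)
  ... | yes c = ≡mod-weaken (ℤ.∣-reflexive (pos-^ n (suc f))) (begin
    ∑[ q < n ^ f ] R (q * n ℕ.+ r)
      ≡⟨ ∑-cong (n ^ f) unit-term ⟩
    ∑[ q < n ^ f ] ((+ r +ᶻ + n *ᶻ + q) ^ᶻ M -ᶻ 1ℤ)
      ≈⟨ ∑-progression-^-1≡0 n (carmichael⇒∣∑ carmichael) M f (carmichael-^-≡1 carmichael (suc f) c) ⟩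
    0ℤ
      ∎)
    where
    open ≡mod-Reasoning ((+ n) ^ᶻ suc f)
    unit-term : ∀ q → R (q * n ℕ.+ r) ≡ (+ r +ᶻ + n *ᶻ + q) ^ᶻ M -ᶻ 1ℤ
    unit-term q =
      trans (restrict-accept (Q? (q * n ℕ.+ r)) (coprime⇒gcd≡1 (coprime-^ (coprime-*-+ q c) (suc f))))
            (cong (_-ᶻ 1ℤ) (trans (pos-^ _ M) (cong (_^ᶻ M) (pos-*-+ q n r))))

  ∑-units-^-1≡0 : ∑[ k < N ] R k ≡ᶻ 0ℤ [mod + N ]
  ∑-units-^-1≡0 = begin
    ∑[ k < n * n ^ f ] R k                    ≡⟨ cong (λ m → ∑ m R) (ℕ.*-comm n (n ^ f)) ⟩
    ∑[ k < n ^ f * n ] R k                    ≡⟨ ∑-by-residue (n ^ f) n R ⟩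
    ∑[ r < n ] ∑[ q < n ^ f ] R (q * n ℕ.+ r) ≈⟨ ∑-cong-mod n ∑-residue-class≡0 ⟩
    ∑[ r < n ] 0ℤ                             ≡⟨ ∑-0 n ⟩
    0ℤ                                        ∎
    where open ≡mod-Reasoning (+ N)

  ^-suc-weakCarmichael : IsWeakCarmichael N
  ^-suc-weakCarmichael = composite-N , toℕ-≡mod (begin
    + sum (map (λ k → k ^ M) (filter Q? (range1 N)))   ≡⟨ weak-sum≡∑ N 1<N ⟩
    ∑[ k < N ] restrict (Q? k) (+ (k ^ M))              ≡⟨ ∑-cong N (λ k → split (Q? k) (+ (k ^ M))) ⟩
    ∑[ k < N ] (R k +ᶻ restrict (Q? k) 1ℤ)              ≡⟨ ∑-+ N R (λ k → restrict (Q? k) 1ℤ) ⟩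
    ∑[ k < N ] R k +ᶻ ∑[ k < N ] restrict (Q? k) 1ℤ     ≈⟨ +-cong-mod ∑-units-^-1≡0 ≡mod-refl ⟩
    0ℤ +ᶻ ∑[ k < N ] restrict (Q? k) 1ℤ                 ≡⟨ ℤ.+-identityˡ _ ⟩
    ∑[ k < N ] restrict (Q? k) 1ℤ                       ≡⟨ φ≡∑ N 1<N ⟨
    + φ N                                               ∎)
    where
    open ≡mod-Reasoning (+ N)
    composite = proj₁ carmichael
    composite-N : Composite N
    composite-N = composite-∣ {{ℕ.m^n≢0 n (suc f) {{composite⇒nonZero composite}}}}
                              composite (m∣m*n (n ^ f))
    1<N : 1 < N
    1<N = ℕ.nonTrivial⇒n>1 N {{composite⇒nonTrivial composite-N}}
    split : ∀ {p} {P : Set p} (P? : Dec P) x → restrict P? x ≡ restrict P? (x -ᶻ 1ℤ) +ᶻ restrict P? 1ℤ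
    split P? x = trans (cong (restrict P?) (add-back x)) (restrict-+ P? (x -ᶻ 1ℤ) 1ℤ)
      where
      add-back : ∀ x → x ≡ x -ᶻ 1ℤ +ᶻ 1ℤ
      add-back = solve-∀

carmichael⇒^-weakCarmichael : ∀ {n} → IsCarmichael n → ∀ e → .{{NonZero e}} → IsWeakCarmichael (n ^ e)
carmichael⇒^-weakCarmichael carmichael (suc f) = ^-suc-weakCarmichael carmichael f

corollary2p53 : (n : ℕ) → IsCarmichael n → (l : ℕ) → IsCarmichaelλ n l →
    (d : ℕ) → 0 < d →
    IsWeakCarmichael (n ^ (d * l)) × IsWeakCarmichael (n ^ (d * φ n))
corollary2p53 n carmichael@(composite , _) l (0<l , _) d 0<d =
  carmichael⇒^-weakCarmichael carmichael (d * l) {{ℕ.m*n≢0 d l}} ,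
  carmichael⇒^-weakCarmichael carmichael (d * φ n) {{ℕ.m*n≢0 d (φ n)}}
  where
  instance
    _ = ℕ.>-nonZero 0<d
    _ = ℕ.>-nonZero 0<l
    _ = ℕ.>-nonZero (φ>0 n {{composite⇒nonZero composite}})
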